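{- Let $r\ge2$, let $\ell_1,\dots,\ell_r\ge1$ be integers and $\alpha\in W(\ell_1,\dots,\ell_r)$, $d=\sum_{s\in[r]}(\ell_s-1)$. Then for any integers $\lambda_1,\dots,\lambda_r$ with $1\le\lambda_s\le\ell_s$ for all $s\in[r]$ and $\lambda_s<\ell_s$ for at least one $s\in[r]$, there is a unique integer $0\le i\le d-1$ such that, for $\sigma:=\alpha_{i+1}$, \[ \nu_{i,\sigma}=\lambda_\sigma\quad\text{and}\quad \nu_{i,s}\le\lambda_s\ \text{ for all } s\in[r]\setminus\{\sigma\}. \] Moreover, for this $i$ we have $\lambda_\sigma<\ell_\sigma$.
   Context: $[r]=\{1,\dots,r\}$. $W(\ell_1,\dots,\ell_r)$ is the set of sequences $\alpha=(\alpha_1,\dots,\alpha_d)$ of length $d=\sum_{s\in[r]}(\ell_s-1)$ with entries in $[r]$ having exactly $\ell_s-1$ entries equal to $s$ for each $s\in[r]$. For $0\le i\le d$ and $s\in[r]$, $\nu_{i,s}:=1+|\{1\le j\le i:\alpha_j=s\}|$. -}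

module Defs where

open import Data.Nat using (ℕ; suc; _∸_; _≤_; _<_)
open import Data.Fin using (Fin; toℕ)
open import Data.Fin.Properties using (_≟_)
open import Data.List using (List; length; take; filter; lookup; map; allFin)
open import Data.Nat.ListAction using (sum)
open import Data.Product using (_×_)
open import Relation.Binary.PropositionalEquality using (_≡_; _≢_)

count : {r : ℕ} → Fin r → List (Fin r) → ℕ
count s w = length (filter (_≟ s) w)

dim : {r : ℕ} → (Fin r → ℕ) → ℕ
dim {r} ℓ = sum (map (λ s → ℓ s ∸ 1) (allFin r))

InW : {r : ℕ} → (Fin r → ℕ) → List (Fin r) → Set
InW {r} ℓ α = (length α ≡ dim ℓ) × ((s : Fin r) → count s α ≡ ℓ s ∸ 1)

ν : {r : ℕ} → List (Fin r) → ℕ → Fin r → ℕ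
ν α i s = suc (count s (take i α))

-- the condition on 0 ≤ i ≤ d-1 (i as an index into α, so α_{i+1} = lookup α i)
Cond : {r : ℕ} → (α : List (Fin r)) → (Fin r → ℕ) → Fin (length α) → Set
Cond {r} α λ' i =
  (ν α (toℕ i) (lookup α i) ≡ λ' (lookup α i)) ×
  ((s : Fin r) → s ≢ lookup α i → ν α (toℕ i) s ≤ λ' s)

module Submission where

-- For a prefix length n of the word α, say that n *fits* λ' when
-- ν_{n,s} ≤ λ'_s for every letter s.  Fitting is downward closed in n, since
-- every ν_{n,s} grows with n; it holds at n = 0 (all ν_{0,s} = 1 ≤ λ'_s) and
-- fails at n = d (ν_{d,s} = ℓ_s > λ'_s for the letter with λ'_s < ℓ_s).
-- Passing from i to i+1 only increments the coordinate σ = α_{i+1}, so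
-- Cond α λ' i holds exactly when i fits and i+1 does not: the condition
-- ν_{i,σ} = λ'_σ is precisely what makes the increment break the bound.
-- Hence the required index is the crossing point of a downward-closed
-- decidable predicate on 0,…,d, which exists and is unique.  Finally
-- λ'_σ = ν_{i,σ} < ν_{i+1,σ} ≤ ν_{d,σ} = ℓ_σ.

open import Defs
open import Data.Nat using (ℕ; zero; suc; _+_; _≤_; _<_; z≤n; s≤s; >-nonZero)
open import Data.Nat.Properties
  using (≤-refl; ≤-trans; <-≤-trans; ≤-reflexive; +-comm; +-identityʳ;
         +-monoʳ-≤; <-cmp; m<n⇒m<1+n; ≤∧≢⇒<; n≮n; _≤?_; suc-pred)
import Data.Nat.Properties as ℕ
open import Data.Fin using (Fin; toℕ; fromℕ<)
open import Data.Fin.Properties using (_≟_; all?; toℕ<n; toℕ-fromℕ<; toℕ-injective)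
open import Data.List using (List; []; _∷_; _++_; [_]; length; lookup; take; filter)
open import Data.List.Properties using (length-++; filter-++; take-suc; take-all)
open import Data.Product using (Σ; ∃; _×_; _,_; proj₁; proj₂)
open import Data.Empty using (⊥-elim)
open import Relation.Nullary using (¬_; yes; no)
open import Relation.Unary using (Decidable)
open import Relation.Binary using (tri<; tri≈; tri>)
open import Relation.Binary.PropositionalEquality
  using (_≡_; _≢_; refl; sym; trans; cong; subst; subst₂; module ≡-Reasoning)

module _ {r : ℕ} where

  count-++ : (s : Fin r) (xs ys : List (Fin r)) → count s (xs ++ ys) ≡ count s xs + count s ys
  count-++ s xs ys = trans (cong length (filter-++ (_≟ s) xs ys)) (length-++ (filter (_≟ s) xs))

  count-self : (s : Fin r) → count s [ s ] ≡ 1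
  count-self s with s ≟ s
  ... | yes _ = refl
  ... | no s≢s = ⊥-elim (s≢s refl)

  count-other : (s x : Fin r) → x ≢ s → count s [ x ] ≡ 0
  count-other s x x≢s with x ≟ s
  ... | yes x≡s = ⊥-elim (x≢s x≡s)
  ... | no _ = refl

  count-take-mono : (s : Fin r) (w : List (Fin r)) {m n : ℕ} → m ≤ n →
                    count s (take m w) ≤ count s (take n w)
  count-take-mono s w z≤n = z≤n
  count-take-mono s [] (s≤s _) = z≤n
  count-take-mono s (x ∷ w) {suc m} {suc n} (s≤s m≤n) =
    subst₂ _≤_ (sym (count-++ s [ x ] (take m w))) (sym (count-++ s [ x ] (take n w)))
               (+-monoʳ-≤ (count s [ x ]) (count-take-mono s w m≤n))

  count-take-suc : (s : Fin r) (α : List (Fin r)) (i : Fin (length α)) →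
                   count s (take (suc (toℕ i)) α) ≡ count s (take (toℕ i) α) + count s [ lookup α i ]
  count-take-suc s α i = trans (cong (count s) (take-suc α i)) (count-++ s (take (toℕ i) α) _)

  ν-step-self : (α : List (Fin r)) (i : Fin (length α)) →
                ν α (suc (toℕ i)) (lookup α i) ≡ suc (ν α (toℕ i) (lookup α i))
  ν-step-self α i = cong suc (begin
    count σ (take (suc (toℕ i)) α)    ≡⟨ count-take-suc σ α i ⟩
    count σ (take (toℕ i) α) + count σ [ σ ]
      ≡⟨ cong (count σ (take (toℕ i) α) +_) (count-self σ) ⟩
    count σ (take (toℕ i) α) + 1      ≡⟨ +-comm _ 1 ⟩
    suc (count σ (take (toℕ i) α))    ∎)
    where
    open ≡-Reasoning
    σ : Fin r
    σ = lookup α i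

  ν-step-other : (α : List (Fin r)) (i : Fin (length α)) (s : Fin r) → s ≢ lookup α i →
                 ν α (suc (toℕ i)) s ≡ ν α (toℕ i) s
  ν-step-other α i s s≢σ = cong suc (begin
    count s (take (suc (toℕ i)) α)    ≡⟨ count-take-suc s α i ⟩
    count s (take (toℕ i) α) + count s [ lookup α i ]
      ≡⟨ cong (count s (take (toℕ i) α) +_) (count-other s (lookup α i) (λ σ≡s → s≢σ (sym σ≡s))) ⟩
    count s (take (toℕ i) α) + 0      ≡⟨ +-identityʳ _ ⟩
    count s (take (toℕ i) α)          ∎)
    where open ≡-Reasoning

  ν-mono : (α : List (Fin r)) (s : Fin r) {m n : ℕ} → m ≤ n → ν α m s ≤ ν α n s
  ν-mono α s m≤n = s≤s (count-take-mono s α m≤n)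

  ν-full : (α : List (Fin r)) (s : Fin r) → ν α (length α) s ≡ suc (count s α)
  ν-full α s = cong (λ w → suc (count s w)) (take-all (length α) α ≤-refl)

crossing : {P : ℕ → Set} → Decidable P → (n : ℕ) → P 0 → ¬ P n →
           ∃ λ m → m < n × P m × ¬ P (suc m)
crossing P? zero P0 ¬Pn = ⊥-elim (¬Pn P0)
crossing P? (suc n) P0 ¬Psn with P? n
... | yes Pn = n , ≤-refl , Pn , ¬Psn
... | no ¬Pn with crossing P? n P0 ¬Pn
...   | m , m<n , Pm , ¬Psm = m , m<n⇒m<1+n m<n , Pm , ¬Psm

crossing-unique : {P : ℕ → Set} → (∀ {m n} → m ≤ n → P n → P m) →
                  {m n : ℕ} → P m → ¬ P (suc m) → P n → ¬ P (suc n) → m ≡ n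
crossing-unique down {m} {n} Pm ¬Psm Pn ¬Psn with <-cmp m n
... | tri< m<n _ _ = ⊥-elim (¬Psm (down m<n Pn))
... | tri≈ _ m≡n _ = m≡n
... | tri> _ _ n<m = ⊥-elim (¬Psn (down n<m Pm))

module _ {r : ℕ} (α : List (Fin r)) (λ' : Fin r → ℕ) where

  Fits : ℕ → Set
  Fits n = (s : Fin r) → ν α n s ≤ λ' s

  fits? : Decidable Fits
  fits? n = all? (λ s → ν α n s ≤? λ' s)

  fits-down : ∀ {m n} → m ≤ n → Fits n → Fits m
  fits-down m≤n fitsₙ s = ≤-trans (ν-mono α s m≤n) (fitsₙ s)

  Cond⇒crossing : (i : Fin (length α)) → Cond α λ' i →
                  Fits (toℕ i) × ¬ Fits (suc (toℕ i))
  Cond⇒crossing i (ν≡λ , ν≤λ) = fitsᵢ , misfit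
    where
    σ : Fin r
    σ = lookup α i
    fitsᵢ : Fits (toℕ i)
    fitsᵢ s with s ≟ σ
    ... | yes refl = ≤-reflexive ν≡λ
    ... | no s≢σ = ν≤λ s s≢σ
    misfit : ¬ Fits (suc (toℕ i))
    misfit fits = n≮n (λ' σ) (subst (_≤ λ' σ) (trans (ν-step-self α i) (cong suc ν≡λ)) (fits σ))

  crossing⇒Cond : (i : Fin (length α)) → Fits (toℕ i) → ¬ Fits (suc (toℕ i)) → Cond α λ' i
  crossing⇒Cond i fitsᵢ misfit = ν≡λ , λ s _ → fitsᵢ s
    where
    σ : Fin r
    σ = lookup α i
    fits-next : ν α (toℕ i) σ < λ' σ → Fits (suc (toℕ i))
    fits-next ν<λ s with s ≟ σ
    ... | yes refl = subst (_≤ λ' σ) (sym (ν-step-self α i)) ν<λ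
    ... | no s≢σ = subst (_≤ λ' s) (sym (ν-step-other α i s s≢σ)) (fitsᵢ s)
    ν≡λ : ν α (toℕ i) σ ≡ λ' σ
    ν≡λ with ν α (toℕ i) σ ℕ.≟ λ' σ
    ... | yes eq = eq
    ... | no ne = ⊥-elim (misfit (fits-next (≤∧≢⇒< (fitsᵢ σ) ne)))

  Cond⇒below-full : (i : Fin (length α)) → Cond α λ' i →
                    λ' (lookup α i) < ν α (length α) (lookup α i)
  Cond⇒below-full i (ν≡λ , _) =
    <-≤-trans (subst (_< ν α (suc (toℕ i)) σ) ν≡λ (≤-reflexive (sym (ν-step-self α i))))
              (ν-mono α σ (toℕ<n i))
    where
    σ : Fin r
    σ = lookup α i

  Cond-exists : Fits 0 → ¬ Fits (length α) → Σ (Fin (length α)) (Cond α λ')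
  Cond-exists fits-start misfit-end
    with crossing fits? (length α) fits-start misfit-end
  ... | m , m<d , fitsₘ , misfitₘ = i , crossing⇒Cond i (subst Fits i≡m fitsₘ)
                                                    (subst (λ k → ¬ Fits (suc k)) i≡m misfitₘ)
    where
    i : Fin (length α)
    i = fromℕ< m<d
    i≡m : m ≡ toℕ i
    i≡m = sym (toℕ-fromℕ< m<d)

  Cond-unique : (i j : Fin (length α)) → Cond α λ' i → Cond α λ' j → j ≡ i
  Cond-unique i j condᵢ condⱼ with Cond⇒crossing i condᵢ | Cond⇒crossing j condⱼ
  ... | fitsᵢ , misfitᵢ | fitsⱼ , misfitⱼ =
    toℕ-injective (crossing-unique fits-down fitsⱼ misfitⱼ fitsᵢ misfitᵢ)

lemma13 : (r : ℕ) → 2 ≤ r → (ℓ : Fin r → ℕ) → ((s : Fin r) → 1 ≤ ℓ s) →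
    (α : List (Fin r)) → InW ℓ α →
    (λ' : Fin r → ℕ) → ((s : Fin r) → 1 ≤ λ' s × λ' s ≤ ℓ s) →
    ∃ (λ s → λ' s < ℓ s) →
    Σ (Fin (length α)) (λ i →
      Cond α λ' i ×
      ((j : Fin (length α)) → Cond α λ' j → j ≡ i) ×
      λ' (lookup α i) < ℓ (lookup α i))
lemma13 r _ ℓ ℓ≥1 α (_ , countα) λ' λ-bounds (s₀ , λs₀<ℓs₀) =
  i , condᵢ , (λ j condⱼ → Cond-unique α λ' i j condᵢ condⱼ) ,
  subst (λ' (lookup α i) <_) (ν-end (lookup α i)) (Cond⇒below-full α λ' i condᵢ)
  where
  -- ν_{d,s} = 1 + (ℓ_s - 1) = ℓ_s, since ℓ_s ≥ 1.
  ν-end : (s : Fin r) → ν α (length α) s ≡ ℓ s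
  ν-end s = trans (ν-full α s) (trans (cong suc (countα s)) (suc-pred (ℓ s) {{>-nonZero (ℓ≥1 s)}}))

  fits-start : Fits α λ' 0
  fits-start s = proj₁ (λ-bounds s)

  misfit-end : ¬ Fits α λ' (length α)
  misfit-end fits = n≮n (λ' s₀) (<-≤-trans λs₀<ℓs₀ (subst (_≤ λ' s₀) (ν-end s₀) (fits s₀)))

  i : Fin (length α)
  i = proj₁ (Cond-exists α λ' fits-start misfit-end)

  condᵢ : Cond α λ' i
  condᵢ = proj₂ (Cond-exists α λ' fits-start misfit-end)
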